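{- Let $\mathcal{F}=\bigwedge_{j=1}^m c_j$ be a CNF formula over variables $X$, and fix $1\le k\le m$. Let $\mathcal{L}_c$ be the set of literals over $X$ whose variable does not occur in $c_k$, let $\mathcal{F}^{\mathrm{IcX}}=\neg c_k\wedge\bigwedge_{i\ne k}c_i$, let $\mathcal{R}=\mathcal{L}_c$, and for $\mathcal{W}\subseteq\mathcal{R}$ let $P(\mathcal{W})=\neg\mathrm{SAT}\big(\mathcal{F}^{\mathrm{IcX}}\wedge\bigvee_{l\in\mathcal{R}\setminus\mathcal{W}}l\big)$. Then $P$ is monotone, and for a minimal subset $\mathcal{W}\subseteq\mathcal{R}$ for $P$, the clause $u=c_k\cup(\mathcal{R}\setminus\mathcal{W})$ is a longest extension of the implicate $c_k$ of $\mathcal{F}$. (Hence FLEIc reduces to the MSMP problem.)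
   Context: A clause is a non-tautologous disjunction of literals, identified with its set of literals; a CNF formula is a set (conjunction) of clauses. An empty disjunction is false. $\mathrm{SAT}(\varphi)$ is $1$ iff $\varphi$ is satisfiable. A predicate $P:2^{\mathcal{R}}\to\{0,1\}$ is monotone if $P(\mathcal{R}_0)$ and $\mathcal{R}_0\subseteq\mathcal{R}_1\subseteq\mathcal{R}$ imply $P(\mathcal{R}_1)$; $\mathcal{M}\subseteq\mathcal{R}$ is minimal for $P$ if $P(\mathcal{M})$ holds and $P(\mathcal{M}')$ fails for every $\mathcal{M}'\subsetneq\mathcal{M}$. The MSMP problem asks for a minimal set for a given monotone predicate. For an implicate $c$ that is a clause of $\mathcal{F}$, a clause $u\supseteq c$ is a longest extension of $c$ iff $(\mathcal{F}\setminus\{c\})\cup\{u\}\equiv\mathcal{F}$ and $(\mathcal{F}\setminus\{c\})\cup\{u'\}\not\equiv\mathcal{F}$ for every clause $u'\supsetneq u$.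
   Formalization: The longest-extension conclusion covers only those minimal $\mathcal{W}$ for which $u=c_k\cup(\mathcal{R}\setminus\mathcal{W})$ contains no variable together with its negation, that is, for which u is non-tautologous. The statement above fails without it. -}

module Defs where

open import Data.Nat using (ℕ)
open import Data.Fin using (Fin; _≟_)
open import Data.Bool using (Bool; true; false; _∧_; _∨_; not; if_then_else_)
open import Data.Product using (Σ; ∃; _×_; _,_; proj₁)
open import Relation.Nullary using (¬_; yes; no)
open import Relation.Binary.PropositionalEquality using (_≡_; _≢_)

-- Variables X = Fin n.  A literal is a variable with a polarity:
-- (x , true) is the positive literal x, (x , false) is ¬x.
Lit : ℕ → Set
Lit n = Fin n × Bool

var : ∀ {n} → Lit n → Fin n
var = proj₁

Assignment : ℕ → Set
Assignment n = Fin n → Bool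

LitTrue : ∀ {n} → Assignment n → Lit n → Set
LitTrue a (x , b) = a x ≡ b

LitSet : ℕ → Set
LitSet n = Lit n → Bool

_∈ₗ_ : ∀ {n} → Lit n → LitSet n → Set
l ∈ₗ S = S l ≡ true

_⊆ₗ_ : ∀ {n} → LitSet n → LitSet n → Set
S ⊆ₗ T = ∀ l → l ∈ₗ S → l ∈ₗ T

_⊊ₗ_ : ∀ {n} → LitSet n → LitSet n → Set
S ⊊ₗ T = S ⊆ₗ T × ∃ λ l → (l ∈ₗ T) × ¬ (l ∈ₗ S)

_∪ₗ_ : ∀ {n} → LitSet n → LitSet n → LitSet n
(S ∪ₗ T) l = S l ∨ T l

_∖ₗ_ : ∀ {n} → LitSet n → LitSet n → LitSet n
(S ∖ₗ T) l = S l ∧ not (T l)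

DisjSat : ∀ {n} → Assignment n → LitSet n → Set
DisjSat a S = ∃ λ l → (l ∈ₗ S) × LitTrue a l

NonTaut : ∀ {n} → LitSet n → Set
NonTaut S = ∀ x → ¬ (((x , true) ∈ₗ S) × ((x , false) ∈ₗ S))

Clause : ℕ → Set
Clause n = Σ (LitSet n) NonTaut

lits : ∀ {n} → Clause n → LitSet n
lits = proj₁

ClauseSat : ∀ {n} → Assignment n → Clause n → Set
ClauseSat a c = DisjSat a (lits c)

Occurs : ∀ {n} → Fin n → LitSet n → Bool
Occurs x S = S (x , true) ∨ S (x , false)

Formula : ℕ → Set₁
Formula n = Assignment n → Set

SAT : ∀ {n} → Formula n → Set
SAT φ = ∃ λ a → φ a

_≡F_ : ∀ {n} → Formula n → Formula n → Set
φ ≡F ψ = ∀ a → (φ a → ψ a) × (ψ a → φ a)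

CNF : ℕ → ℕ → Set
CNF n m = Fin m → Clause n

⟦_⟧ : ∀ {n m} → CNF n m → Formula n
⟦ F ⟧ a = ∀ i → ClauseSat a (F i)

-- (F ∖ {c_k}) ∪ {u}: the k-th clause replaced by u
replaceAt : ∀ {n m} → CNF n m → Fin m → Clause n → CNF n m
replaceAt F k u i with i ≟ k
... | yes _ = u
... | no  _ = F i

Monotone : ∀ {n} → LitSet n → (LitSet n → Set) → Set
Monotone R P = ∀ R₀ R₁ → R₀ ⊆ₗ R₁ → R₁ ⊆ₗ R → P R₀ → P R₁

MinimalFor : ∀ {n} → LitSet n → (LitSet n → Set) → LitSet n → Set
MinimalFor R P M = M ⊆ₗ R × P M × (∀ M' → M' ⊊ₗ M → ¬ P M')

LongestExtension : ∀ {n m} → CNF n m → Fin m → Clause n → Set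
LongestExtension {n} F k u =
  (lits (F k) ⊆ₗ lits u)
  × (⟦ replaceAt F k u ⟧ ≡F ⟦ F ⟧)
  × (∀ (u' : Clause n) → lits u ⊊ₗ lits u' → ¬ (⟦ replaceAt F k u' ⟧ ≡F ⟦ F ⟧))

Lc : ∀ {n m} → CNF n m → Fin m → LitSet n
Lc F k l = not (Occurs (var l) (lits (F k)))

FIcX : ∀ {n m} → CNF n m → Fin m → Formula n
FIcX F k a = (¬ ClauseSat a (F k)) × (∀ i → i ≢ k → ClauseSat a (F i))

Pred : ∀ {n m} → CNF n m → Fin m → LitSet n → Set
Pred F k W = ¬ SAT (λ a → FIcX F k a × DisjSat a (Lc F k ∖ₗ W))

uSet : ∀ {n m} → CNF n m → Fin m → LitSet n → LitSet n
uSet F k W = lits (F k) ∪ₗ (Lc F k ∖ₗ W)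

{-# OPTIONS --safe #-}
module Submission where

-- Call a set of literals S extendable when ¬ c_k ∧ ⋀_{i ≠ k} c_i ∧ ⋁ S is
-- unsatisfiable. For a clause u ⊇ c_k, replacing c_k by u preserves F exactly
-- when u is extendable, and P(W) says that 𝓛_c ∖ W is extendable. Since
-- extendability is antitone, P is monotone, and c_k ∪ (𝓛_c ∖ W) is extendable
-- (every literal of c_k is falsified) whenever P(W) holds. If a non-tautologous
-- clause u' ⊋ u still preserved F, a literal l ∈ u' ∖ u could not have its
-- variable in c_k ⊆ u', so l ∈ 𝓛_c and hence l ∈ W; then 𝓛_c ∖ (W ∖ {l}) ⊆ u'
-- would be extendable, contradicting the minimality of W.

open import Defs
open import Data.Nat using (ℕ)
open import Data.Fin using (Fin; _≟_)
open import Data.Fin.Properties using (any?)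
open import Data.Bool using (true; false; not)
import Data.Bool.Properties as Bool
open import Data.Product using (∃; _×_; _,_; proj₁; proj₂)
open import Data.Product.Properties using (≡-dec)
open import Data.Sum using (_⊎_; inj₁; inj₂)
open import Function using (_∘_)
open import Relation.Nullary using (¬_; Dec; yes; no; contradiction)
open import Relation.Nullary.Decidable using (⌊_⌋; map′; decidable-stable)
open import Relation.Binary.PropositionalEquality using (_≡_; _≢_; refl; cong; subst)

private
  variable
    n m : ℕ
    a : Assignment n
    S T U : LitSet n
    l : Lit n

_∉ₗ_ : Lit n → LitSet n → Set
l ∉ₗ S = ¬ l ∈ₗ S

⊆ₗ-trans : S ⊆ₗ T → T ⊆ₗ U → S ⊆ₗ U
⊆ₗ-trans S⊆T T⊆U l = T⊆U l ∘ S⊆T l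

S⊆ₗS∪ₗT : S ⊆ₗ (S ∪ₗ T)
S⊆ₗS∪ₗT l l∈S rewrite l∈S = refl

T⊆ₗS∪ₗT : T ⊆ₗ (S ∪ₗ T)
T⊆ₗS∪ₗT {S = S} l l∈T with S l
... | true  = refl
... | false = l∈T

l∈S∪ₗT⁻ : ∀ (S T : LitSet n) → l ∈ₗ (S ∪ₗ T) → l ∈ₗ S ⊎ l ∈ₗ T
l∈S∪ₗT⁻ {l = l} S T l∈S∪T with S l
... | true  = inj₁ refl
... | false = inj₂ l∈S∪T

l∈S∖ₗT⁻ : ∀ (S T : LitSet n) → l ∈ₗ (S ∖ₗ T) → l ∈ₗ S × l ∉ₗ T
l∈S∖ₗT⁻ {l = l} S T l∈S∖T with S l | T l
... | true | false = refl , λ ()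

l∈S∖ₗT⁺ : ∀ (S T : LitSet n) → l ∈ₗ S → l ∉ₗ T → l ∈ₗ (S ∖ₗ T)
l∈S∖ₗT⁺ {l = l} S T l∈S l∉T rewrite l∈S | Bool.¬-not l∉T = refl

l∉S∖ₗT⇒l∈T : l ∈ₗ S → l ∉ₗ (S ∖ₗ T) → l ∈ₗ T
l∉S∖ₗT⇒l∈T {l = l} {S = S} {T = T} l∈S l∉S∖T with T l Bool.≟ true
... | yes l∈T = l∈T
... | no l∉T  = contradiction (l∈S∖ₗT⁺ S T l∈S l∉T) l∉S∖T

∖ₗ-antitoneʳ : T ⊆ₗ U → (S ∖ₗ U) ⊆ₗ (S ∖ₗ T)
∖ₗ-antitoneʳ {T = T} {U = U} {S = S} T⊆U l l∈S∖U =
  let l∈S , l∉U = l∈S∖ₗT⁻ S U l∈S∖U in l∈S∖ₗT⁺ S T l∈S (l∉U ∘ T⊆U l)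

_≟ₗ_ : (l l′ : Lit n) → Dec (l ≡ l′)
_≟ₗ_ = ≡-dec _≟_ Bool._≟_

｛_｝ₗ : Lit n → LitSet n
｛ l ｝ₗ l′ = ⌊ l′ ≟ₗ l ⌋

l∈｛l｝ₗ : l ∈ₗ ｛ l ｝ₗ
l∈｛l｝ₗ {l = l} with l ≟ₗ l
... | yes _   = refl
... | no l≢l = contradiction refl l≢l

l′∈｛l｝ₗ⁻ : ∀ {l′ : Lit n} → l′ ∈ₗ ｛ l ｝ₗ → l′ ≡ l
l′∈｛l｝ₗ⁻ {l = l} {l′} l′∈｛l｝ with l′ ≟ₗ l
... | yes l′≡l = l′≡l

S∖ₗ｛l｝ₗ⊊ₗS : l ∈ₗ S → (S ∖ₗ ｛ l ｝ₗ) ⊊ₗ S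
S∖ₗ｛l｝ₗ⊊ₗS {l = l} {S = S} l∈S =
  (λ l′ → proj₁ ∘ l∈S∖ₗT⁻ S ｛ l ｝ₗ) , l , l∈S ,
  λ l∈S∖｛l｝ → proj₂ (l∈S∖ₗT⁻ S ｛ l ｝ₗ l∈S∖｛l｝) l∈｛l｝ₗ

∖ₗ-restore-⊆ : (S ∖ₗ T) ⊆ₗ U → l ∈ₗ U → (S ∖ₗ (T ∖ₗ ｛ l ｝ₗ)) ⊆ₗ U
∖ₗ-restore-⊆ {S = S} {T = T} {U = U} {l = l} S∖T⊆U l∈U l′ l′∈S∖T∖｛l｝ = restore (l′ ≟ₗ l)
  where
  restore : Dec (l′ ≡ l) → l′ ∈ₗ U
  restore (yes refl) = l∈U
  restore (no l′≢l)  = S∖T⊆U l′ (l∈S∖ₗT⁺ S T l′∈S l′∉T)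
    where
    l′∈S : l′ ∈ₗ S
    l′∈S = proj₁ (l∈S∖ₗT⁻ S (T ∖ₗ ｛ l ｝ₗ) l′∈S∖T∖｛l｝)
    l′∉T∖｛l｝ : l′ ∉ₗ (T ∖ₗ ｛ l ｝ₗ)
    l′∉T∖｛l｝ = proj₂ (l∈S∖ₗT⁻ S (T ∖ₗ ｛ l ｝ₗ) l′∈S∖T∖｛l｝)
    l′∉T : l′ ∉ₗ T
    l′∉T l′∈T = l′∉T∖｛l｝ (l∈S∖ₗT⁺ T ｛ l ｝ₗ l′∈T (l′≢l ∘ l′∈｛l｝ₗ⁻))

NonTaut-polarity : ∀ {x b b′} → NonTaut S → (x , b) ∈ₗ S → (x , b′) ∈ₗ S → b ≡ b′
NonTaut-polarity {b = true}  {true}  _ _ _ = refl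
NonTaut-polarity {b = false} {false} _ _ _ = refl
NonTaut-polarity {x = x} {true}  {false} nt p q = contradiction (p , q) (nt x)
NonTaut-polarity {x = x} {false} {true}  nt p q = contradiction (q , p) (nt x)

Occurs⁻ : ∀ {x} → Occurs x S ≡ true → ∃ λ b → (x , b) ∈ₗ S
Occurs⁻ {S = S} {x} occurs with S (x , true) in eq
... | true  = true , eq
... | false = false , occurs

-- Adding a literal of the other polarity would make U tautologous.
NonTaut-¬Occurs : ∀ {x b} → NonTaut U → S ⊆ₗ U →
                  (x , b) ∈ₗ U → (x , b) ∉ₗ S → Occurs x S ≡ false
NonTaut-¬Occurs {U = U} {S = S} {x = x} {b} nt S⊆U xb∈U xb∉S with Occurs x S in eq
... | false = refl
... | true  with Occurs⁻ {S = S} eq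
...   | b′ , xb′∈S with NonTaut-polarity {S = U} {x} {b} {b′} nt xb∈U (S⊆U (x , b′) xb′∈S)
...     | refl = contradiction xb′∈S xb∉S

DisjSat-mono : S ⊆ₗ T → DisjSat a S → DisjSat a T
DisjSat-mono S⊆T (l , l∈S , l-true) = l , S⊆T l l∈S , l-true

DisjSat? : (a : Assignment n) (S : LitSet n) → Dec (DisjSat a S)
DisjSat? a S = map′ (λ (x , p) → (x , a x) , p , refl)
                    (λ { ((x , _) , p , refl) → x , p })
                    (any? λ x → S (x , a x) Bool.≟ true)

replaceAt-at : ∀ (F : CNF n m) k u → replaceAt F k u k ≡ u
replaceAt-at F k u with k ≟ k
... | yes _   = refl
... | no k≢k = contradiction refl k≢k

replaceAt-other : ∀ (F : CNF n m) {k} u {i} → i ≢ k → replaceAt F k u i ≡ F i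
replaceAt-other F {k} u {i} i≢k with i ≟ k
... | yes i≡k = contradiction i≡k i≢k
... | no _    = refl

module _ (F : CNF n m) (k : Fin m) where

  Others : Formula n
  Others a = ∀ i → i ≢ k → ClauseSat a (F i)

  ⟦replaceAt⟧⁺ : ∀ {u} → ClauseSat a u → Others a → ⟦ replaceAt F k u ⟧ a
  ⟦replaceAt⟧⁺ u-sat others i with i ≟ k
  ... | yes _   = u-sat
  ... | no i≢k = others i i≢k

  ⟦replaceAt⟧⁻ : ∀ {u} → ⟦ replaceAt F k u ⟧ a → ClauseSat a u × Others a
  ⟦replaceAt⟧⁻ {a = a} {u} h =
    subst (ClauseSat a) (replaceAt-at F k u) (h k) ,
    λ i i≢k → subst (ClauseSat a) (replaceAt-other F u i≢k) (h i)

  Extendable : LitSet n → Set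
  Extendable S = ¬ SAT (λ a → FIcX F k a × DisjSat a S)

  Extendable-antitone : S ⊆ₗ T → Extendable T → Extendable S
  Extendable-antitone S⊆T ext (a , icx , S-sat) = ext (a , icx , DisjSat-mono S⊆T S-sat)

  Extendable-∪ₗ : Extendable S → Extendable (lits (F k) ∪ₗ S)
  Extendable-∪ₗ {S = S} ext (a , icx@(¬ck , _) , l , l∈ck∪S , l-true)
    with l∈S∪ₗT⁻ (lits (F k)) S l∈ck∪S
  ... | inj₁ l∈ck = ¬ck (l , l∈ck , l-true)
  ... | inj₂ l∈S  = ext (a , icx , l , l∈S , l-true)

  -- Clause satisfaction is decidable, so c_k holds as soon as its failure is refuted.
  Extendable⇒replaceAt-≡F : ∀ {u} → lits (F k) ⊆ₗ lits u → Extendable (lits u) →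
                            ⟦ replaceAt F k u ⟧ ≡F ⟦ F ⟧
  Extendable⇒replaceAt-≡F {u} ck⊆u ext a = to , from
    where
    to : ⟦ replaceAt F k u ⟧ a → ⟦ F ⟧ a
    to h i with ⟦replaceAt⟧⁻ h | i ≟ k
    ... | u-sat , others | yes refl =
      decidable-stable (DisjSat? a (lits (F k))) λ ¬ck → ext (a , (¬ck , others) , u-sat)
    ... | _ , others | no i≢k = others i i≢k

    from : ⟦ F ⟧ a → ⟦ replaceAt F k u ⟧ a
    from h = ⟦replaceAt⟧⁺ (DisjSat-mono ck⊆u (h k)) λ i _ → h i

  replaceAt-≡F⇒Extendable : ∀ {u} → ⟦ replaceAt F k u ⟧ ≡F ⟦ F ⟧ → Extendable (lits u)
  replaceAt-≡F⇒Extendable equiv (a , (¬ck , others) , u-sat) =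
    ¬ck (proj₁ (equiv a) (⟦replaceAt⟧⁺ u-sat others) k)

  Pred-monotone : Monotone (Lc F k) (Pred F k)
  Pred-monotone R₀ R₁ R₀⊆R₁ _ = Extendable-antitone (∖ₗ-antitoneʳ R₀⊆R₁)

  ck⊆uSet : ∀ W → lits (F k) ⊆ₗ uSet F k W
  ck⊆uSet W = S⊆ₗS∪ₗT {S = lits (F k)} {T = Lc F k ∖ₗ W}

  Lc∖W⊆uSet : ∀ W → (Lc F k ∖ₗ W) ⊆ₗ uSet F k W
  Lc∖W⊆uSet W = T⊆ₗS∪ₗT {T = Lc F k ∖ₗ W} {S = lits (F k)}

  module _ {W : LitSet n} (minimal : MinimalFor (Lc F k) (Pred F k) W)
           (nt : NonTaut (uSet F k W)) where

    uSet-≡F : ⟦ replaceAt F k (uSet F k W , nt) ⟧ ≡F ⟦ F ⟧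
    uSet-≡F = Extendable⇒replaceAt-≡F (ck⊆uSet W) (Extendable-∪ₗ (proj₁ (proj₂ minimal)))

    uSet-longest : ∀ (u′ : Clause n) → uSet F k W ⊊ₗ lits u′ →
                   ¬ (⟦ replaceAt F k u′ ⟧ ≡F ⟦ F ⟧)
    uSet-longest (U′ , nt′) (u⊆U′ , l , l∈U′ , l∉u) equiv =
      proj₂ (proj₂ minimal) (W ∖ₗ ｛ l ｝ₗ) (S∖ₗ｛l｝ₗ⊊ₗS l∈W)
        (Extendable-antitone (∖ₗ-restore-⊆ {S = Lc F k} (⊆ₗ-trans (Lc∖W⊆uSet W) u⊆U′) l∈U′)
          (replaceAt-≡F⇒Extendable equiv))
      where
      l∈Lc : l ∈ₗ Lc F k
      l∈Lc = cong not
        (NonTaut-¬Occurs nt′ (⊆ₗ-trans (ck⊆uSet W) u⊆U′) l∈U′ (l∉u ∘ ck⊆uSet W l))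

      l∈W : l ∈ₗ W
      l∈W = l∉S∖ₗT⇒l∈T {S = Lc F k} {T = W} l∈Lc (l∉u ∘ Lc∖W⊆uSet W l)

proposition18 : ∀ {n m} (F : CNF n m) (k : Fin m) →
    Monotone (Lc F k) (Pred F k)
    × (∀ (W : LitSet n) → MinimalFor (Lc F k) (Pred F k) W →
         (nt : NonTaut (uSet F k W)) →
         LongestExtension F k (uSet F k W , nt))
proposition18 F k =
  Pred-monotone F k ,
  λ W minimal nt → ck⊆uSet F k W , uSet-≡F F k minimal nt , uSet-longest F k minimal nt
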